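{- Fix $n,K\in\mathbb{N}$, a distribution $\tilde F$ on $[K]$, and any online stopping algorithm for $n$ values in discrete time. Let $F_k$ ($k\in[K]$) be $\tilde F$ conditioned on values at most $k$ ($F_k(\ell)=\tilde F(\ell)/\tilde F(k)$ for $\ell\le k$, $=1$ for $\ell>k$), and $\Pr_k$ probability when values are i.i.d. from $F_k$. Then for any $t\in[n]$ and $\ell\in[K]$, the conditional probabilities \[ \Pr_k\big[\mathrm{ALG}=t \mid \mathrm{ALG}\ge t,\ x_t=\max_{1\le i\le t}x_i=\ell\big] \] are identical for all $k$ with $\ell\le k\le K$.
   Context: Discrete-time model: values $x_1,\dots,x_n$ are revealed in order; after seeing $x_t$ a (possibly randomized) algorithm irrevocably accepts (and stops) or rejects it, accepting at most one; its decisions depend only on observed values and internal randomness. $\mathrm{ALG}$ denotes the index of the accepted value.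
   Formalization: The distribution $\tilde F$ has rational point masses, and the algorithm is given by rational probabilities of accepting each value given the observed values and that it has not yet stopped. -}

module Defs where

open import Data.Nat as ℕ using (ℕ; zero; suc)
open import Data.Fin as Fin using (Fin)
open import Data.List using (List; allFin; []; _∷_; map; concatMap; take; foldr; length; last)
open import Data.List.Relation.Unary.All using (All; all?)
open import Data.Maybe using (Maybe; just; nothing)
open import Data.Rational using (ℚ; 0ℚ; 1ℚ; _+_; _*_; _-_; _÷_; _≤_; _<_; positive)
open import Data.Rational.Properties using (pos⇒nonZero)
open import Relation.Nullary using (Dec; yes; no)
open import Relation.Binary.PropositionalEquality using (_≡_)

-- Values lie in [K] = {1,…,K}; the value j is represented by (i : Fin K) with toℕ i = j - 1.
-- The order on values is the order on Fin K.

sumℚ : List ℚ → ℚ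
sumℚ = foldr _+_ 0ℚ

record Dist (K : ℕ) : Set where
  field
    mass     : Fin K → ℚ
    mass≥0   : ∀ i → 0ℚ ≤ mass i
    mass-sum : sumℚ (map mass (allFin K)) ≡ 1ℚ
open Dist public

cdf : ∀ {K} → Dist K → Fin K → ℚ
cdf {K} F k = sumℚ (map (λ j → massLe j) (allFin K))
  where
  massLe : Fin K → ℚ
  massLe j with j Fin.≤? k
  ... | yes _ = mass F j
  ... | no  _ = 0ℚ

divPos : (p q : ℚ) → 0ℚ < q → ℚ
divPos p q h = _÷_ p q {{pos⇒nonZero q {{positive h}}}}

condMass : ∀ {K} (F : Dist K) (k : Fin K) → 0ℚ < cdf F k → Fin K → ℚ
condMass F k h j with j Fin.≤? k
... | yes _ = divPos (mass F j) (cdf F k) h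
... | no  _ = 0ℚ

seqs : ∀ {K} → ℕ → List (List (Fin K))
seqs zero    = [] ∷ []
seqs {K} (suc m) = concatMap (λ v → map (v ∷_) (seqs m)) (allFin K)

weight : ∀ {K} → (Fin K → ℚ) → List (Fin K) → ℚ
weight p = foldr (λ v w → p v * w) 1ℚ

-- A (possibly randomized) online stopping algorithm, described by its
-- acceptance probabilities: accept h is the probability that the algorithm
-- accepts the last value of the observed history h (h = x₁ … x_s, nonempty
-- in use), given that it has rejected x₁ … x_{s-1}.
record Algorithm (K : ℕ) : Set where
  field
    accept   : List (Fin K) → ℚ
    accept≥0 : ∀ h → 0ℚ ≤ accept h
    accept≤1 : ∀ h → accept h ≤ 1ℚ
open Algorithm public

-- Pr[ALG ≥ t | x] = Π_{s=1}^{t-1} (1 - accept(x₁…x_s))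
survive : ∀ {K} → Algorithm K → List (Fin K) → ℕ → ℚ
survive A x zero          = 1ℚ
survive A x (suc zero)    = 1ℚ
survive A x (suc (suc s)) = survive A x (suc s) * (1ℚ - accept A (take (suc s) x))

-- Pr[ALG = t | x] restricted to ALG ≥ t : survive · accept(x₁…x_t)
stopAt : ∀ {K} → Algorithm K → List (Fin K) → ℕ → ℚ
stopAt A x t = survive A x t * accept A (take t x)

isMaxAt : ∀ {K} → List (Fin K) → ℕ → Fin K → ℚ
isMaxAt x t ℓ with last (take t x)
... | nothing = 0ℚ
... | just v with v Fin.≟ ℓ | all? (λ u → u Fin.≤? ℓ) (take t x)
...   | yes _ | yes _ = 1ℚ
...   | _     | _     = 0ℚ

-- Pr_k[ALG ≥ t ∧ x_t = max_{i≤t} x_i = ℓ]  (values i.i.d. from F_k, n values)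
probB : ∀ {K} (n : ℕ) (F : Dist K) (k : Fin K) → 0ℚ < cdf F k →
        Algorithm K → ℕ → Fin K → ℚ
probB n F k h A t ℓ =
  sumℚ (map (λ x → weight (condMass F k h) x * isMaxAt x t ℓ * survive A x t) (seqs n))

-- Pr_k[ALG = t ∧ ALG ≥ t ∧ x_t = max_{i≤t} x_i = ℓ]
probAB : ∀ {K} (n : ℕ) (F : Dist K) (k : Fin K) → 0ℚ < cdf F k →
         Algorithm K → ℕ → Fin K → ℚ
probAB n F k h A t ℓ =
  sumℚ (map (λ x → weight (condMass F k h) x * isMaxAt x t ℓ * stopAt A x t) (seqs n))

condProb : ∀ {K} (n : ℕ) (F : Dist K) (k : Fin K) (h : 0ℚ < cdf F k)
           (A : Algorithm K) (t : ℕ) (ℓ : Fin K) → 0ℚ < probB n F k h A t ℓ → ℚ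
condProb n F k h A t ℓ hB = divPos (probAB n F k h A t ℓ) (probB n F k h A t ℓ) hB

{-# OPTIONS --safe #-}

-- Write a sequence of n = t + m values as a prefix p of length t followed by a suffix q.
-- Both events {ALG ≥ t, x_t = max_{i≤t} x_i = ℓ} and {ALG = t, x_t = max_{i≤t} x_i = ℓ}
-- depend on p only, so under the product measure their Pr_k-probabilities factor as
-- (total F_k-mass of the suffixes) · (F_k-mass of the prefixes in the event).  On the event
-- every value of p is ≤ ℓ ≤ k, where F_k's point masses are those of F̃ divided by F̃(k), so
-- the prefix part is F̃(k)^(-t) times its F̃-mass.  Both probabilities are therefore the same
-- k-dependent factor times a k-independent quantity, and the factor cancels in the quotient.

module Submission where

open import Defs
open import Data.Nat using (ℕ; zero; suc)
import Data.Nat as N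
import Data.Nat.Properties as NP
open import Data.Fin using (Fin)
import Data.Fin as F
import Data.Fin.Properties as FP
open import Data.List using (List; []; _∷_; _++_; map; concat; concatMap; take; length; last; allFin)
open import Data.List.Properties
  using (map-cong; map-cong-local; map-∘; map-concatMap; take-take; take-all)
open import Data.List.Relation.Unary.All as All using (All; all?)
open import Data.List.Relation.Unary.All.Properties using (concat⁺; map⁺)
open import Data.Maybe using (just; nothing)
open import Data.Rational
  using (ℚ; 0ℚ; 1ℚ; _+_; _*_; _-_; 1/_; _<_; NonZero; ≢-nonZero; positive; +-*-rawSemiring)
import Data.Rational.Properties as QP
open import Data.Rational.Solver using (module +-*-Solver)
open import Algebra.Definitions.RawSemiring +-*-rawSemiring using (_^_)
open import Data.Product using (_,_)
open import Data.Sum using (_⊎_; inj₁; inj₂)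
open import Function using (_∘_)
open import Relation.Nullary using (yes; no; contradiction)
open import Relation.Binary.PropositionalEquality
  using (_≡_; refl; sym; trans; cong; cong₂; subst; module ≡-Reasoning)

open +-*-Solver
open ≡-Reasoning

*-cancelˡ-≡ : ∀ p q r .{{_ : NonZero p}} → p * q ≡ p * r → q ≡ r
*-cancelˡ-≡ p q r e = begin
  q                ≡⟨ QP.*-identityˡ q ⟨
  1ℚ * q           ≡⟨ cong (_* q) (QP.*-inverseˡ p) ⟨
  1/ p * p * q     ≡⟨ QP.*-assoc (1/ p) p q ⟩
  1/ p * (p * q)   ≡⟨ cong (1/ p *_) e ⟩
  1/ p * (p * r)   ≡⟨ QP.*-assoc (1/ p) p r ⟨
  1/ p * p * r     ≡⟨ cong (_* r) (QP.*-inverseˡ p) ⟩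
  1ℚ * r           ≡⟨ QP.*-identityˡ r ⟩
  r                ∎

*-cancelʳ-≡ : ∀ p q r .{{_ : NonZero r}} → p * r ≡ q * r → p ≡ q
*-cancelʳ-≡ p q r e = *-cancelˡ-≡ r p q (trans (QP.*-comm r p) (trans e (QP.*-comm q r)))

pos-*⇒nonZeroˡ : ∀ p q → 0ℚ < p * q → NonZero p
pos-*⇒nonZeroˡ p q pq>0 = ≢-nonZero {p} λ p≡0 →
  QP.<-irrefl refl (subst (0ℚ <_) (trans (cong (_* q) p≡0) (QP.*-zeroˡ q)) pq>0)

pos-*⇒nonZeroʳ : ∀ p q → 0ℚ < p * q → NonZero q
pos-*⇒nonZeroʳ p q pq>0 = pos-*⇒nonZeroˡ q p (subst (0ℚ <_) (QP.*-comm p q) pq>0)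

divPos-*ʳ : ∀ p q (h : 0ℚ < q) → divPos p q h * q ≡ p
divPos-*ʳ p q h = begin
  p * 1/ q * q     ≡⟨ QP.*-assoc p (1/ q) q ⟩
  p * (1/ q * q)   ≡⟨ cong (p *_) (QP.*-inverseˡ q) ⟩
  p * 1ℚ           ≡⟨ QP.*-identityʳ p ⟩
  p                ∎
  where instance _ = QP.pos⇒nonZero q {{positive h}}

divPos-scale : ∀ a b c (h : 0ℚ < c * b) → divPos (c * a) (c * b) h * b ≡ a
divPos-scale a b c h = *-cancelˡ-≡ c _ a (begin
  c * (r * b)      ≡⟨ solve 3 (λ c r b → c :* (r :* b) := r :* (c :* b)) refl c r b ⟩
  r * (c * b)      ≡⟨ divPos-*ʳ (c * a) (c * b) h ⟩
  c * a            ∎)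
  where
  r = divPos (c * a) (c * b) h
  instance _ = pos-*⇒nonZeroˡ c b h

divPos-scale-invariant : ∀ {a b p q p′ q′} c c′ (h : 0ℚ < q) (h′ : 0ℚ < q′) →
                         p ≡ c * a → q ≡ c * b → p′ ≡ c′ * a → q′ ≡ c′ * b →
                         divPos p q h ≡ divPos p′ q′ h′
divPos-scale-invariant {a} {b} c c′ h h′ refl refl refl refl =
  *-cancelʳ-≡ _ _ b (trans (divPos-scale a b c h) (sym (divPos-scale a b c′ h′)))
  where instance _ = pos-*⇒nonZeroʳ c b h

take-length-++ : ∀ {A : Set} (p q : List A) → take (length p) (p ++ q) ≡ p
take-length-++ []      q = refl
take-length-++ (x ∷ p) q = cong (x ∷_) (take-length-++ p q)

sumℚ-++ : (xs ys : List ℚ) → sumℚ (xs ++ ys) ≡ sumℚ xs + sumℚ ys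
sumℚ-++ []       ys = sym (QP.+-identityˡ _)
sumℚ-++ (x ∷ xs) ys = trans (cong (x +_) (sumℚ-++ xs ys)) (sym (QP.+-assoc x _ _))

sumℚ-concat : (xss : List (List ℚ)) → sumℚ (concat xss) ≡ sumℚ (map sumℚ xss)
sumℚ-concat []         = refl
sumℚ-concat (xs ∷ xss) = trans (sumℚ-++ xs (concat xss)) (cong (sumℚ xs +_) (sumℚ-concat xss))

sumℚ-concatMap : ∀ {A B : Set} (f : B → ℚ) (g : A → List B) (xs : List A) →
                 sumℚ (map f (concatMap g xs)) ≡ sumℚ (map (λ a → sumℚ (map f (g a))) xs)
sumℚ-concatMap f g xs = begin
  sumℚ (map f (concatMap g xs))                  ≡⟨ cong sumℚ (map-concatMap f g xs) ⟩
  sumℚ (concat (map (map f ∘ g) xs))             ≡⟨ sumℚ-concat (map (map f ∘ g) xs) ⟩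
  sumℚ (map sumℚ (map (map f ∘ g) xs))           ≡⟨ cong sumℚ (map-∘ xs) ⟨
  sumℚ (map (λ a → sumℚ (map f (g a))) xs)       ∎

sumℚ-*ˡ : ∀ {A : Set} (c : ℚ) (f : A → ℚ) (xs : List A) →
          sumℚ (map (λ x → c * f x) xs) ≡ c * sumℚ (map f xs)
sumℚ-*ˡ c f []       = sym (QP.*-zeroʳ c)
sumℚ-*ˡ c f (x ∷ xs) =
  trans (cong (c * f x +_) (sumℚ-*ˡ c f xs)) (sym (QP.*-distribˡ-+ c (f x) _))

sumℚ-*ʳ : ∀ {A : Set} (c : ℚ) (f : A → ℚ) (xs : List A) →
          sumℚ (map (λ x → f x * c) xs) ≡ sumℚ (map f xs) * c
sumℚ-*ʳ c f xs = begin
  sumℚ (map (λ x → f x * c) xs)   ≡⟨ cong sumℚ (map-cong (λ x → QP.*-comm (f x) c) xs) ⟩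
  sumℚ (map (λ x → c * f x) xs)   ≡⟨ sumℚ-*ˡ c f xs ⟩
  c * sumℚ (map f xs)             ≡⟨ QP.*-comm c _ ⟩
  sumℚ (map f xs) * c             ∎

seqs-length : ∀ {K} t → All (λ p → length p ≡ t) (seqs {K} t)
seqs-length zero        = refl All.∷ All.[]
seqs-length {K} (suc t) =
  concat⁺ (map⁺ (All.universal (λ _ → map⁺ (All.map (cong suc) (seqs-length t))) (allFin K)))

sumℚ-seqs-+ : ∀ {K} a b (f : List (Fin K) → ℚ) →
              sumℚ (map f (seqs (a N.+ b))) ≡
              sumℚ (map (λ p → sumℚ (map (λ q → f (p ++ q)) (seqs b))) (seqs a))
sumℚ-seqs-+ zero    b f = sym (QP.+-identityʳ _)
sumℚ-seqs-+ {K} (suc a) b f = begin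
  sumℚ (map f (seqs (suc a N.+ b)))
    ≡⟨ sumℚ-concatMap f (λ v → map (v ∷_) (seqs (a N.+ b))) (allFin K) ⟩
  sumℚ (map (λ v → sumℚ (map f (map (v ∷_) (seqs (a N.+ b))))) (allFin K))
    ≡⟨ cong sumℚ (map-cong (λ v → trans (sym (cong sumℚ (map-∘ (seqs (a N.+ b)))))
                                         (sumℚ-seqs-+ a b (f ∘ (v ∷_))))
                           (allFin K)) ⟩
  sumℚ (map (λ v → sumℚ (map (inner ∘ (v ∷_)) (seqs a))) (allFin K))
    ≡⟨ cong sumℚ (map-cong (λ v → cong sumℚ (map-∘ (seqs a))) (allFin K)) ⟩
  sumℚ (map (λ v → sumℚ (map inner (map (v ∷_) (seqs a)))) (allFin K))
    ≡⟨ sumℚ-concatMap inner (λ v → map (v ∷_) (seqs a)) (allFin K) ⟨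
  sumℚ (map inner (seqs (suc a)))
    ∎
  where
  inner : List (Fin K) → ℚ
  inner p = sumℚ (map (λ q → f (p ++ q)) (seqs b))

weight-++ : ∀ {K} (w : Fin K → ℚ) (p q : List (Fin K)) →
            weight w (p ++ q) ≡ weight w p * weight w q
weight-++ w []      q = sym (QP.*-identityˡ _)
weight-++ w (v ∷ p) q = trans (cong (w v *_) (weight-++ w p q)) (sym (QP.*-assoc (w v) _ _))

weight-scale : ∀ {K} {w w′ : Fin K → ℚ} {c : ℚ} {p : List (Fin K)} →
               All (λ v → w′ v ≡ w v * c) p → weight w′ p ≡ weight w p * c ^ length p
weight-scale All.[] = sym (QP.*-identityˡ _)
weight-scale {w = w} {c = c} {v ∷ p} (e All.∷ es) rewrite e | weight-scale {w = w} es =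
  solve 4 (λ a c W C → (a :* c) :* (W :* C) := (a :* W) :* (c :* C)) refl
    (w v) c (weight w p) (c ^ length p)

expect : ∀ {K} → (Fin K → ℚ) → ℕ → (List (Fin K) → ℚ) → ℚ
expect w n g = sumℚ (map (λ x → weight w x * g x) (seqs n))

PrefixDetermined : ∀ {K} → ℕ → (List (Fin K) → ℚ) → Set
PrefixDetermined t g = ∀ {x y} → take t x ≡ take t y → g x ≡ g y

PrefixDetermined-mono : ∀ {K} {m n} {g : List (Fin K) → ℚ} →
                        m N.≤ n → PrefixDetermined m g → PrefixDetermined n g
PrefixDetermined-mono {m = m} {n} m≤n det {x} {y} e = det (begin
  take m x              ≡⟨ cong (λ i → take i x) (NP.m≤n⇒m⊓n≡m m≤n) ⟨
  take (m N.⊓ n) x      ≡⟨ take-take m n x ⟨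
  take m (take n x)     ≡⟨ cong (take m) e ⟩
  take m (take n y)     ≡⟨ take-take m n y ⟩
  take (m N.⊓ n) y      ≡⟨ cong (λ i → take i y) (NP.m≤n⇒m⊓n≡m m≤n) ⟩
  take m y              ∎)

PrefixDetermined-* : ∀ {K} {t} {f g : List (Fin K) → ℚ} →
                     PrefixDetermined t f → PrefixDetermined t g →
                     PrefixDetermined t (λ x → f x * g x)
PrefixDetermined-* detf detg e = cong₂ _*_ (detf e) (detg e)

expect-+ : ∀ {K} (w : Fin K → ℚ) t m {g : List (Fin K) → ℚ} → PrefixDetermined t g →
           expect w (t N.+ m) g ≡ sumℚ (map (weight w) (seqs m)) * expect w t g
expect-+ w t m {g} det = begin
  expect w (t N.+ m) g
    ≡⟨ sumℚ-seqs-+ t m (λ x → weight w x * g x) ⟩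
  sumℚ (map (λ p → sumℚ (map (λ q → weight w (p ++ q) * g (p ++ q)) (seqs m))) (seqs t))
    ≡⟨ cong sumℚ (map-cong-local (All.map (λ {p} → factor p) (seqs-length t))) ⟩
  sumℚ (map (λ p → Z * (weight w p * g p)) (seqs t))
    ≡⟨ sumℚ-*ˡ Z (λ p → weight w p * g p) (seqs t) ⟩
  Z * expect w t g
    ∎
  where
  Z : ℚ
  Z = sumℚ (map (weight w) (seqs m))

  term : ∀ p q → length p ≡ t →
         weight w (p ++ q) * g (p ++ q) ≡ weight w q * (weight w p * g p)
  term p q refl rewrite weight-++ w p q
                      | det {p ++ q} {p} (trans (take-length-++ p q)
                                               (sym (take-all _ p NP.≤-refl))) =
    solve 3 (λ P Q G → (P :* Q) :* G := Q :* (P :* G)) refl (weight w p) (weight w q) (g p)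

  factor : ∀ p → length p ≡ t →
           sumℚ (map (λ q → weight w (p ++ q) * g (p ++ q)) (seqs m)) ≡ Z * (weight w p * g p)
  factor p lp = trans (cong sumℚ (map-cong (λ q → term p q lp) (seqs m)))
                      (sumℚ-*ʳ (weight w p * g p) (weight w) (seqs m))

expect-scale : ∀ {K} {w w′ : Fin K → ℚ} (c : ℚ) t {g : List (Fin K) → ℚ} →
               (∀ p → length p ≡ t → g p ≡ 0ℚ ⊎ All (λ v → w′ v ≡ w v * c) p) →
               expect w′ t g ≡ c ^ t * expect w t g
expect-scale {w = w} {w′} c t {g} scaled =
  trans (cong sumℚ (map-cong-local (All.map (λ {p} → term p) (seqs-length t))))
        (sumℚ-*ˡ (c ^ t) (λ p → weight w p * g p) (seqs t))
  where
  term : ∀ p → length p ≡ t → weight w′ p * g p ≡ c ^ t * (weight w p * g p)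
  term p lp with scaled p lp
  ... | inj₁ g≡0 rewrite g≡0 =
    solve 3 (λ W′ C W → W′ :* con 0ℚ := C :* (W :* con 0ℚ)) refl (weight w′ p) (c ^ t) (weight w p)
  ... | inj₂ e rewrite weight-scale {w = w} e | lp =
    solve 3 (λ W C G → (W :* C) :* G := C :* (W :* G)) refl (weight w p) (c ^ t) (g p)

condMass-≤ : ∀ {K} (F̃ : Dist K) {k j} (h : 0ℚ < cdf F̃ k) → j F.≤ k →
             condMass F̃ k h j ≡ mass F̃ j * divPos 1ℚ (cdf F̃ k) h
condMass-≤ F̃ {k} {j} h j≤k with j F.≤? k
... | yes _   = cong (mass F̃ j *_) (sym (QP.*-identityˡ _))
... | no  j≰k = contradiction j≤k j≰k

isMaxAt-cases : ∀ {K} (x : List (Fin K)) t ℓ → isMaxAt x t ℓ ≡ 0ℚ ⊎ All (F._≤ ℓ) (take t x)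
isMaxAt-cases x t ℓ with last (take t x)
... | nothing = inj₁ refl
... | just v with v F.≟ ℓ | all? (F._≤? ℓ) (take t x)
...   | yes _ | yes x≤ℓ = inj₂ x≤ℓ
...   | yes _ | no  _   = inj₁ refl
...   | no  _ | _       = inj₁ refl

isMaxAt-prefixDetermined : ∀ {K} t (ℓ : Fin K) → PrefixDetermined t (λ x → isMaxAt x t ℓ)
isMaxAt-prefixDetermined t ℓ {x} {y} e with last (take t x) | last (take t y) | cong last e
... | nothing | _ | refl = refl
... | just v  | _ | refl with v F.≟ ℓ | all? (F._≤? ℓ) (take t x) | all? (F._≤? ℓ) (take t y)
...   | no  _ | _       | _       = refl
...   | yes _ | yes _   | yes _   = refl
...   | yes _ | no  _   | no  _   = refl
...   | yes _ | no  x≰ℓ | yes y≤ℓ = contradiction (subst (All (F._≤ ℓ)) (sym e) y≤ℓ) x≰ℓ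
...   | yes _ | yes x≤ℓ | no  y≰ℓ = contradiction (subst (All (F._≤ ℓ)) e x≤ℓ) y≰ℓ

survive-prefixDetermined : ∀ {K} (A : Algorithm K) s → PrefixDetermined s (λ x → survive A x s)
survive-prefixDetermined A zero                _ = refl
survive-prefixDetermined A (suc zero)          _ = refl
survive-prefixDetermined A (suc (suc s)) =
  PrefixDetermined-mono (NP.n≤1+n (suc s))
    (PrefixDetermined-* (survive-prefixDetermined A (suc s)) (cong (λ h → 1ℚ - accept A h)))

stopAt-prefixDetermined : ∀ {K} (A : Algorithm K) s → PrefixDetermined s (λ x → stopAt A x s)
stopAt-prefixDetermined A s = PrefixDetermined-* (survive-prefixDetermined A s) (cong (accept A))

conditioningFactor : ∀ {K} (F̃ : Dist K) k → 0ℚ < cdf F̃ k → (t m : ℕ) → ℚ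
conditioningFactor F̃ k h t m =
  sumℚ (map (weight (condMass F̃ k h)) (seqs m)) * divPos 1ℚ (cdf F̃ k) h ^ t

isMaxAt-condMass-factor :
  ∀ {K} (F̃ : Dist K) {k} (h : 0ℚ < cdf F̃ k) t m {ℓ} → ℓ F.≤ k →
  {H : List (Fin K) → ℚ} → PrefixDetermined t H →
  sumℚ (map (λ x → weight (condMass F̃ k h) x * isMaxAt x t ℓ * H x) (seqs (t N.+ m))) ≡
  conditioningFactor F̃ k h t m * expect (mass F̃) t (λ x → isMaxAt x t ℓ * H x)
isMaxAt-condMass-factor {K} F̃ {k} h t m {ℓ} ℓ≤k {H} det = begin
  sumℚ (map (λ x → weight wₖ x * isMaxAt x t ℓ * H x) (seqs (t N.+ m)))
    ≡⟨ cong sumℚ (map-cong (λ x → QP.*-assoc (weight wₖ x) _ _) (seqs (t N.+ m))) ⟩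
  expect wₖ (t N.+ m) G
    ≡⟨ expect-+ wₖ t m (PrefixDetermined-* (isMaxAt-prefixDetermined t ℓ) det) ⟩
  Z * expect wₖ t G
    ≡⟨ cong (Z *_) (expect-scale {w = mass F̃} c t scaled) ⟩
  Z * (c ^ t * expect (mass F̃) t G)
    ≡⟨ QP.*-assoc Z (c ^ t) _ ⟨
  conditioningFactor F̃ k h t m * expect (mass F̃) t G
    ∎
  where
  wₖ : Fin K → ℚ
  wₖ = condMass F̃ k h

  c Z : ℚ
  c = divPos 1ℚ (cdf F̃ k) h
  Z = sumℚ (map (weight wₖ) (seqs m))

  G : List (Fin K) → ℚ
  G x = isMaxAt x t ℓ * H x

  scaled : ∀ p → length p ≡ t → G p ≡ 0ℚ ⊎ All (λ v → wₖ v ≡ mass F̃ v * c) p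
  scaled p lp with isMaxAt-cases p t ℓ
  ... | inj₁ e   = inj₁ (trans (cong (_* H p) e) (QP.*-zeroˡ (H p)))
  ... | inj₂ p≤ℓ = inj₂ (All.map (λ v≤ℓ → condMass-≤ F̃ h (FP.≤-trans v≤ℓ ℓ≤k))
                                 (subst (All (F._≤ ℓ)) (take-all t p (NP.≤-reflexive lp)) p≤ℓ))

lemma40 : (n K : ℕ) (Ft : Dist K) (A : Algorithm K) (t : ℕ) (ℓ : Fin K) →
          1 N.≤ t → t N.≤ n →
          (k k′ : Fin K) → ℓ F.≤ k → ℓ F.≤ k′ →
          (hk : 0ℚ < cdf Ft k) (hk′ : 0ℚ < cdf Ft k′) →
          (hB : 0ℚ < probB n Ft k hk A t ℓ) (hB′ : 0ℚ < probB n Ft k′ hk′ A t ℓ) →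
          condProb n Ft k hk A t ℓ hB ≡ condProb n Ft k′ hk′ A t ℓ hB′
lemma40 n K Ft A t ℓ _ t≤n k k′ ℓ≤k ℓ≤k′ hk hk′ hB hB′ with NP.m≤n⇒∃[o]m+o≡n t≤n
... | m , refl =
  divPos-scale-invariant (conditioningFactor Ft k hk t m) (conditioningFactor Ft k′ hk′ t m) hB hB′
    (isMaxAt-condMass-factor Ft hk  t m ℓ≤k  (stopAt-prefixDetermined A t))
    (isMaxAt-condMass-factor Ft hk  t m ℓ≤k  (survive-prefixDetermined A t))
    (isMaxAt-condMass-factor Ft hk′ t m ℓ≤k′ (stopAt-prefixDetermined A t))
    (isMaxAt-condMass-factor Ft hk′ t m ℓ≤k′ (survive-prefixDetermined A t))
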